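{- Let $P=x_0,x_1,\ldots,x_n$ with $n>4$ be a path, and let $f$ be a partial 3-star edge coloring of $P$ that colors exactly the edges of the subpaths $x_0,x_1,x_2$ and $x_4,x_5,\ldots,x_n$ (i.e. all edges except $x_2x_3$ and $x_3x_4$), using colors from a fixed set of three colors. Then $f$ can be extended to a 3-star edge coloring of $P$ (with colors from that set) if and only if at least one of the following holds: (i) $n\leq 5$; (ii) $f(x_4x_5)\in\mathcal{F}_P(x_1)$; (iii) $f(x_5x_6)\neq f(x_0x_1)$.
   Context: A $3$-star edge coloring of a graph is a proper edge coloring using at most $3$ colors such that no path and no cycle with four edges is bicolored (i.e. colored with only two colors); a partial 3-star edge coloring is such a coloring of a subset of the edges (proper, and with no bicolored path of four colored edges). For a vertex $x$, $\mathcal{F}_P(x)$ denotes the set of colors of the (colored) edges of $P$ incident to $x$; thus $\mathcal{F}_P(x_1)=\{f(x_0x_1),f(x_1x_2)\}$. -}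

module Defs where

open import Data.Nat using (ℕ; suc; _+_; _<_; _≤_)
open import Data.Fin using (Fin)
open import Data.Maybe using (Maybe; just; nothing)
open import Data.Product using (∃; _×_)
open import Data.Sum using (_⊎_)
open import Relation.Nullary using (¬_)
open import Relation.Binary.PropositionalEquality using (_≡_; _≢_)

Color : Set
Color = Fin 3

-- The path P = x₀,x₁,…,xₙ has edges eᵢ = xᵢxᵢ₊₁ for i < n.
-- A partial edge colouring assigns to edge i either a colour or nothing
-- (uncoloured).  Values at indices i ≥ n are irrelevant.
PColoring : Set
PColoring = ℕ → Maybe Color

Proper : ℕ → PColoring → Set
Proper n f = ∀ i → suc i < n → ∀ a b → f i ≡ just a → f (suc i) ≡ just b → a ≢ b

Bicolored4 : PColoring → ℕ → Set
Bicolored4 f i = ∃ λ a → ∃ λ b → ∀ k → k < 4 →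
  ∃ λ c → f (i + k) ≡ just c × (c ≡ a ⊎ c ≡ b)

-- No bicoloured path with four coloured edges (a path has no cycles, and
-- every 4-edge subpath of P is of the form eᵢ,…,eᵢ₊₃ with i + 4 ≤ n).
NoBicolored4 : ℕ → PColoring → Set
NoBicolored4 n f = ∀ i → i + 4 ≤ n → ¬ Bicolored4 f i

PartialStar : ℕ → PColoring → Set
PartialStar n f = Proper n f × NoBicolored4 n f

StarColoring : ℕ → (ℕ → Color) → Set
StarColoring n g = PartialStar n (λ i → just (g i))

Extends : ℕ → PColoring → (ℕ → Color) → Set
Extends n f g = ∀ i → i < n → ∀ c → f i ≡ just c → g i ≡ c

ColorsAllBut23 : ℕ → PColoring → Set
ColorsAllBut23 n f = ∀ i → i < n →
  ((i ≡ 2 ⊎ i ≡ 3) → f i ≡ nothing) × (i ≢ 2 → i ≢ 3 → ∃ λ c → f i ≡ just c)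

{-# OPTIONS --safe #-}
-- In a proper colouring, a path with four edges is bicoloured exactly when its colours alternate,
-- so only the windows meeting the gap x₂x₃x₄ matter. Let a, b, c, d be the colours of x₀x₁, x₁x₂,
-- x₄x₅, x₅x₆. Giving x₃x₄ the colour y ∉ {c, d} makes every window beyond x₃ safe; x₂x₃ can then
-- take the colour ∉ {b, y}, or, when y = b, the colour ∉ {a, b}, which fails only if a, b, c are
-- distinct and d = a. In that case the only admissible colours of x₂x₃, x₃x₄ are c, a, and then
-- x₂x₃x₄x₅x₆ alternates.
module Submission where

open import Defs
open import Data.Nat using (ℕ; zero; suc; _+_; _<_; _≤_; z≤n; s≤s; z<s; s<s; _≤?_)
open import Data.Nat.Properties using (<⇒≤; <⇒≱; ≰⇒>; ≤-<-trans; +-comm; +-monoʳ-<; <-≤-trans)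
open import Data.Fin using (zero; suc; _≟_)
open import Data.Fin.Properties using (all?)
open import Data.Maybe using (Maybe; just; fromMaybe)
open import Data.Maybe.Properties using (just-injective)
open import Data.Product using (∃; ∃₂; _×_; _,_; proj₁; proj₂)
open import Data.Sum using (_⊎_; inj₁; inj₂)
open import Data.Unit using (tt)
open import Function using (_∘_)
open import Function.Bundles using (_⇔_; mk⇔)
open import Relation.Nullary using (¬_; Dec; yes; no; contradiction)
open import Relation.Nullary.Decidable using (¬?; _→-dec_; toWitness)
open import Relation.Binary.PropositionalEquality using (_≡_; _≢_; refl; sym; trans; cong; subst)

other : Color → Color → Color
other zero (suc zero) = suc (suc zero)
other (suc zero) zero = suc (suc zero)
other zero _ = suc zero
other _ zero = suc zero
other _ _ = zero

other-≢ˡ : ∀ x y → other x y ≢ x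
other-≢ˡ = toWitness {a? = all? λ x → all? λ y → ¬? (other x y ≟ x)} tt

other-≢ʳ : ∀ x y → other x y ≢ y
other-≢ʳ = toWitness {a? = all? λ x → all? λ y → ¬? (other x y ≟ y)} tt

≡-other : ∀ {x y z} → x ≢ y → z ≢ x → z ≢ y → z ≡ other x y
≡-other {x} {y} {z} = toWitness {a? = all? λ x → all? λ y → all? λ z →
  ¬? (x ≟ y) →-dec ¬? (z ≟ x) →-dec ¬? (z ≟ y) →-dec z ≟ other x y} tt x y z

-- x, y colour the gap edges x₂x₃, x₃x₄ of the path coloured a b x y c, which then is proper
-- and has no alternating 4-edge subpath.
record Filling (a b c x y : Color) : Set where
  field
    b≢x : b ≢ x
    x≢y : x ≢ y
    y≢c : y ≢ c
    ¬a≡x×b≡y : ¬ (a ≡ x × b ≡ y)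
    ¬b≡y×x≡c : ¬ (b ≡ y × x ≡ c)

filling-exists : ∀ {a b c d} → a ≢ b → c ≢ d → c ≡ a ⊎ c ≡ b ⊎ d ≢ a →
                 ∃₂ λ x y → Filling a b c x y × y ≢ d
filling-exists {a} {b} {c} {d} a≢b c≢d condition with other c d ≟ b
... | no y≢b = other b (other c d) , other c d , filling , other-≢ʳ c d
  where
  filling : Filling a b c (other b (other c d)) (other c d)
  filling = record
    { b≢x = other-≢ˡ b _ ∘ sym
    ; x≢y = other-≢ʳ b _
    ; y≢c = other-≢ˡ c d
    ; ¬a≡x×b≡y = y≢b ∘ sym ∘ proj₂
    ; ¬b≡y×x≡c = y≢b ∘ sym ∘ proj₁
    }
... | yes y≡b = other a b , other c d , filling , other-≢ʳ c d
  where
  d≢b : d ≢ b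
  d≢b d≡b = other-≢ʳ c d (trans y≡b (sym d≡b))

  c≢x : c ≡ a ⊎ c ≡ b ⊎ d ≢ a → c ≢ other a b
  c≢x (inj₁ c≡a)        c≡x = other-≢ˡ a b (trans (sym c≡x) c≡a)
  c≢x (inj₂ (inj₁ c≡b)) _   = other-≢ˡ c d (trans y≡b (sym c≡b))
  c≢x (inj₂ (inj₂ d≢a)) c≡x = c≢d (trans c≡x (sym (≡-other a≢b d≢a d≢b)))

  filling : Filling a b c (other a b) (other c d)
  filling = record
    { b≢x = other-≢ʳ a b ∘ sym
    ; x≢y = subst (other a b ≢_) (sym y≡b) (other-≢ʳ a b)
    ; y≢c = other-≢ˡ c d
    ; ¬a≡x×b≡y = other-≢ˡ a b ∘ sym ∘ proj₁
    ; ¬b≡y×x≡c = c≢x condition ∘ sym ∘ proj₂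
    }

filling-forced : ∀ {a b c x y} → a ≢ b → c ≢ a → c ≢ b → Filling a b c x y → x ≡ c × y ≡ a
filling-forced {a} {b} {c} {x} {y} a≢b c≢a c≢b filling = x≡c , y≡a
  where
  open Filling filling
  a≢c : a ≢ c
  a≢c = c≢a ∘ sym

  x≢a : x ≢ a
  x≢a x≡a = ¬a≡x×b≡y (sym x≡a , trans b-third (sym y-third))
    where
    b-third : b ≡ other a c
    b-third = ≡-other a≢c (a≢b ∘ sym) (c≢b ∘ sym)
    y-third : y ≡ other a c
    y-third = ≡-other a≢c (x≢y ∘ trans x≡a ∘ sym) y≢c

  x≡c : x ≡ c
  x≡c = trans (≡-other a≢b x≢a (b≢x ∘ sym)) (sym (≡-other a≢b c≢a c≢b))

  y≢b : y ≢ b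
  y≢b y≡b = ¬b≡y×x≡c (sym y≡b , x≡c)

  y≡a : y ≡ a
  y≡a = trans (≡-other (c≢b ∘ sym) y≢b y≢c) (sym (≡-other (c≢b ∘ sym) a≢b a≢c))

Alternating : (ℕ → Color) → ℕ → Set
Alternating g i = g i ≡ g (2 + i) × g (1 + i) ≡ g (3 + i)

≢-unique-in-pair : ∀ {A : Set} {p q w x y : A} → w ≡ p ⊎ w ≡ q → x ≡ p ⊎ x ≡ q → y ≡ p ⊎ y ≡ q →
                   w ≢ x → y ≢ x → w ≡ y
≢-unique-in-pair (inj₁ refl) (inj₁ refl) _           w≢x _   = contradiction refl w≢x
≢-unique-in-pair (inj₂ refl) (inj₂ refl) _           w≢x _   = contradiction refl w≢x
≢-unique-in-pair _           (inj₁ refl) (inj₁ refl) _   y≢x = contradiction refl y≢x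
≢-unique-in-pair _           (inj₂ refl) (inj₂ refl) _   y≢x = contradiction refl y≢x
≢-unique-in-pair (inj₁ refl) (inj₂ refl) (inj₁ refl) _   _   = refl
≢-unique-in-pair (inj₂ refl) (inj₁ refl) (inj₂ refl) _   _   = refl

proper-≢ : ∀ {n} {g : ℕ → Color} → Proper n (λ j → just (g j)) → ∀ i → suc i < n → g i ≢ g (suc i)
proper-≢ proper i i+1<n = proper i i+1<n _ _ refl refl

≢⇒proper : ∀ {n} {g : ℕ → Color} → (∀ i → suc i < n → g i ≢ g (suc i)) → Proper n (λ j → just (g j))
≢⇒proper adjacent i i+1<n _ _ refl refl = adjacent i i+1<n

alternating⇒bicolored : ∀ (g : ℕ → Color) i → Alternating g i → Bicolored4 (λ j → just (g j)) i
alternating⇒bicolored g i (e₀ , e₁) = g i , g (1 + i) , window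
  where
  InPair : Color → Set
  InPair c = c ≡ g i ⊎ c ≡ g (1 + i)

  inPair : ∀ k → k < 4 → InPair (g (k + i))
  inPair 0 _ = inj₁ refl
  inPair 1 _ = inj₂ refl
  inPair 2 _ = inj₁ (sym e₀)
  inPair 3 _ = inj₂ (sym e₁)
  inPair (suc (suc (suc (suc _)))) (s≤s (s≤s (s≤s (s≤s ()))))

  window : ∀ k → k < 4 → ∃ λ c → just (g (i + k)) ≡ just c × InPair c
  window k k<4 = g (i + k) , refl , subst (InPair ∘ g) (+-comm k i) (inPair k k<4)

bicolored⇒alternating : ∀ {n} {g : ℕ → Color} → Proper n (λ j → just (g j)) →
                        ∀ i → i + 4 ≤ n → Bicolored4 (λ j → just (g j)) i → Alternating g i
bicolored⇒alternating {n} {g} proper i i+4≤n (p , q , window) =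
    ≢-unique-in-pair (inPair 0 z<s) (inPair 1 (s<s z<s)) (inPair 2 (s<s (s<s z<s)))
      (proper-≢ proper i (<⇒≤ (<⇒≤ 4+i≤n))) (proper-≢ proper (1 + i) (<⇒≤ 4+i≤n) ∘ sym)
  , ≢-unique-in-pair (inPair 1 (s<s z<s)) (inPair 2 (s<s (s<s z<s))) (inPair 3 (s<s (s<s (s<s z<s))))
      (proper-≢ proper (1 + i) (<⇒≤ 4+i≤n)) (proper-≢ proper (2 + i) 4+i≤n ∘ sym)
  where
  InPair : Color → Set
  InPair c = c ≡ p ⊎ c ≡ q

  4+i≤n : 4 + i ≤ n
  4+i≤n = subst (_≤ n) (+-comm i 4) i+4≤n

  inPair : ∀ k → k < 4 → InPair (g (k + i))
  inPair k k<4 with window k k<4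
  ... | c , g≡c , c∈pq = subst (InPair ∘ g) (+-comm i k) (subst InPair (sym (just-injective g≡c)) c∈pq)

Bicolored4-cong : ∀ {F G : PColoring} i → (∀ k → k < 4 → F (i + k) ≡ G (i + k)) → Bicolored4 G i → Bicolored4 F i
Bicolored4-cong i F≡G (p , q , window) = p , q , λ k k<4 →
  let c , Gk≡c , c∈pq = window k k<4 in c , trans (F≡G k k<4) Gk≡c , c∈pq

-- Uncoloured edges are read as colour zero; this junk value is never looked at.
colour : PColoring → ℕ → Color
colour f i = fromMaybe zero (f i)

patch : PColoring → Color → Color → ℕ → Color
patch f x y 2 = x
patch f x y 3 = y
patch f x y i = colour f i

coloured : ∀ {n f i} → ColorsAllBut23 n f → i < n → i ≢ 2 → i ≢ 3 → f i ≡ just (colour f i)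
coloured CA i<n i≢2 i≢3 with proj₂ (CA _ i<n) i≢2 i≢3
... | c , fi≡c rewrite fi≡c = refl

extension-agrees : ∀ {n f g i} → ColorsAllBut23 n f → Extends n f g → i < n → i ≢ 2 → i ≢ 3 → f i ≡ just (g i)
extension-agrees {f = f} {i = i} CA ext i<n i≢2 i≢3 = trans fi≡c (cong just (sym (ext i i<n _ fi≡c)))
  where
  fi≡c : f i ≡ just (colour f i)
  fi≡c = coloured CA i<n i≢2 i≢3

just-≡⇒≡ : ∀ {A : Set} {u v : Maybe A} {p q} → u ≡ just p → v ≡ just q → u ≡ v → p ≡ q
just-≡⇒≡ u≡p v≡q u≡v = just-injective (trans (sym u≡p) (trans u≡v v≡q))

≡⇒just-≡ : ∀ {A : Set} {u v : Maybe A} {p q} → u ≡ just p → v ≡ just q → p ≡ q → u ≡ v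
≡⇒just-≡ u≡p v≡q p≡q = trans u≡p (trans (cong just p≡q) (sym v≡q))

patch-extends : ∀ {n f x y} → ColorsAllBut23 n f → Extends n f (patch f x y)
patch-extends CA 2 2<n _ f2≡c = contradiction (trans (sym (proj₁ (CA 2 2<n) (inj₁ refl))) f2≡c) λ ()
patch-extends CA 3 3<n _ f3≡c = contradiction (trans (sym (proj₁ (CA 3 3<n) (inj₂ refl))) f3≡c) λ ()
patch-extends CA 0 _ _ f0≡c = cong (fromMaybe zero) f0≡c
patch-extends CA 1 _ _ f1≡c = cong (fromMaybe zero) f1≡c
patch-extends CA (suc (suc (suc (suc _)))) _ _ fi≡c = cong (fromMaybe zero) fi≡c

patch-star : ∀ {n f x y} → ColorsAllBut23 n f → PartialStar n f →
             Filling (colour f 0) (colour f 1) (colour f 4) x y → (6 ≤ n → y ≢ colour f 5) →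
             StarColoring n (patch f x y)
patch-star {n} {f} {x} {y} CA (properF , starF) filling y≢d = properG , starG
  where
  open Filling filling
  g : ℕ → Color
  g = patch f x y

  agrees : ∀ {i} → i < n → i ≢ 2 → i ≢ 3 → f i ≡ just (g i)
  agrees = extension-agrees CA (patch-extends CA)

  properG : Proper n (λ i → just (g i))
  properG = ≢⇒proper adjacent
    where
    adjacent : ∀ i → suc i < n → g i ≢ g (suc i)
    adjacent 0 1<n = properF 0 1<n _ _ (agrees (<⇒≤ 1<n) (λ ()) (λ ())) (agrees 1<n (λ ()) (λ ()))
    adjacent 1 _ = b≢x
    adjacent 2 _ = x≢y
    adjacent 3 _ = y≢c
    adjacent i@(suc (suc (suc (suc _)))) i+1<n =
      properF i i+1<n _ _ (agrees (<⇒≤ i+1<n) (λ ()) (λ ())) (agrees i+1<n (λ ()) (λ ()))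

  starG : NoBicolored4 n (λ i → just (g i))
  starG 0 4≤n = ¬a≡x×b≡y ∘ bicolored⇒alternating properG 0 4≤n
  starG 1 5≤n = ¬b≡y×x≡c ∘ bicolored⇒alternating properG 1 5≤n
  starG 2 6≤n = y≢d 6≤n ∘ proj₂ ∘ bicolored⇒alternating properG 2 6≤n
  starG 3 7≤n = y≢d (<⇒≤ 7≤n) ∘ proj₁ ∘ bicolored⇒alternating properG 3 7≤n
  starG i@(suc (suc (suc (suc _)))) i+4≤n = starF i i+4≤n ∘ Bicolored4-cong {f} {λ j → just (g j)} i
    (λ k k<4 → agrees (<-≤-trans (+-monoʳ-< i k<4) i+4≤n) (λ ()) (λ ()))

star⇒filling : ∀ {n g} → 4 < n → StarColoring n g → Filling (g 0) (g 1) (g 4) (g 2) (g 3)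
star⇒filling {g = g} 4<n (proper , star) = record
  { b≢x = proper-≢ proper 1 (<⇒≤ (<⇒≤ 4<n))
  ; x≢y = proper-≢ proper 2 (<⇒≤ 4<n)
  ; y≢c = proper-≢ proper 3 4<n
  ; ¬a≡x×b≡y = star 0 (<⇒≤ 4<n) ∘ alternating⇒bicolored g 0
  ; ¬b≡y×x≡c = star 1 4<n ∘ alternating⇒bicolored g 1
  }

star-across-gap : ∀ {n g} → 6 ≤ n → StarColoring n g → g 4 ≢ g 0 → g 4 ≢ g 1 → g 5 ≢ g 0
star-across-gap {g = g} 6≤n star@(proper , nonBicolored) c≢a c≢b d≡a =
  let x≡c , y≡a = filling-forced a≢b c≢a c≢b (star⇒filling (<⇒≤ 6≤n) star)
  in  nonBicolored 2 6≤n (alternating⇒bicolored g 2 (x≡c , trans y≡a (sym d≡a)))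
  where
  a≢b : g 0 ≢ g 1
  a≢b = proper-≢ proper 0 (≤-<-trans (s≤s z≤n) 6≤n)

necessity : ∀ {n f} → ColorsAllBut23 n f → (∃ λ g → StarColoring n g × Extends n f g) →
            n ≤ 5 ⊎ (f 4 ≡ f 0 ⊎ f 4 ≡ f 1) ⊎ f 5 ≢ f 0
necessity {n} {f} CA (g , star , ext) with n ≤? 5
... | yes n≤5 = inj₁ n≤5
... | no n≰5 = inj₂ (across-gap (g 4 ≟ g 0) (g 4 ≟ g 1))
  where
  5<n : 5 < n
  5<n = ≰⇒> n≰5

  agrees : ∀ {i} → i < n → i ≢ 2 → i ≢ 3 → f i ≡ just (g i)
  agrees = extension-agrees CA ext

  fa : f 0 ≡ just (g 0)
  fa = agrees (≤-<-trans z≤n 5<n) (λ ()) (λ ())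
  fb : f 1 ≡ just (g 1)
  fb = agrees (≤-<-trans (s≤s z≤n) 5<n) (λ ()) (λ ())
  fc : f 4 ≡ just (g 4)
  fc = agrees (<⇒≤ 5<n) (λ ()) (λ ())
  fd : f 5 ≡ just (g 5)
  fd = agrees 5<n (λ ()) (λ ())

  across-gap : Dec (g 4 ≡ g 0) → Dec (g 4 ≡ g 1) → (f 4 ≡ f 0 ⊎ f 4 ≡ f 1) ⊎ f 5 ≢ f 0
  across-gap (yes c≡a) _         = inj₁ (inj₁ (≡⇒just-≡ fc fa c≡a))
  across-gap (no _)    (yes c≡b) = inj₁ (inj₂ (≡⇒just-≡ fc fb c≡b))
  across-gap (no c≢a)  (no c≢b)  = inj₂ (star-across-gap 5<n star c≢a c≢b ∘ just-≡⇒≡ fd fa)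

sufficiency : ∀ {n f} → 4 < n → ColorsAllBut23 n f → PartialStar n f →
              n ≤ 5 ⊎ (f 4 ≡ f 0 ⊎ f 4 ≡ f 1) ⊎ f 5 ≢ f 0 → ∃ λ g → StarColoring n g × Extends n f g
sufficiency {n} {f} 4<n CA PS@(properF , _) condition =
  let d , c≢d , condition′ , d≡colour₅ = stand-in
      x , y , filling , y≢d = filling-exists a≢b c≢d condition′
  in  patch f x y
    , patch-star CA PS filling (λ 6≤n y≡colour₅ → y≢d (trans y≡colour₅ (sym (d≡colour₅ 6≤n))))
    , patch-extends CA
  where
  a b c : Color
  a = colour f 0
  b = colour f 1
  c = colour f 4

  fa : f 0 ≡ just a
  fa = coloured CA (≤-<-trans z≤n 4<n) (λ ()) (λ ())
  fb : f 1 ≡ just b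
  fb = coloured CA (≤-<-trans (s≤s z≤n) 4<n) (λ ()) (λ ())
  fc : f 4 ≡ just c
  fc = coloured CA 4<n (λ ()) (λ ())

  a≢b : a ≢ b
  a≢b = properF 0 (≤-<-trans (s≤s z≤n) 4<n) a b fa fb

  -- For n = 5 there is no edge x₅x₆, and any colour outside {c, a} can stand in for its colour.
  stand-in : ∃ λ d → c ≢ d × (c ≡ a ⊎ c ≡ b ⊎ d ≢ a) × (6 ≤ n → d ≡ colour f 5)
  stand-in with n ≤? 5
  ... | yes n≤5 = other c a , other-≢ˡ c a ∘ sym , inj₂ (inj₂ (other-≢ʳ c a)) , λ 6≤n → contradiction n≤5 (<⇒≱ 6≤n)
  ... | no n≰5 = colour f 5 , properF 4 5<n c _ fc fd , in-colours condition , λ _ → refl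
    where
    5<n : 5 < n
    5<n = ≰⇒> n≰5
    fd : f 5 ≡ just (colour f 5)
    fd = coloured CA 5<n (λ ()) (λ ())

    in-colours : n ≤ 5 ⊎ (f 4 ≡ f 0 ⊎ f 4 ≡ f 1) ⊎ f 5 ≢ f 0 → c ≡ a ⊎ c ≡ b ⊎ colour f 5 ≢ a
    in-colours (inj₁ n≤5)                = contradiction n≤5 n≰5
    in-colours (inj₂ (inj₁ (inj₁ f4≡f0))) = inj₁ (just-≡⇒≡ fc fa f4≡f0)
    in-colours (inj₂ (inj₁ (inj₂ f4≡f1))) = inj₂ (inj₁ (just-≡⇒≡ fc fb f4≡f1))
    in-colours (inj₂ (inj₂ f5≢f0))        = inj₂ (inj₂ (f5≢f0 ∘ ≡⇒just-≡ fd fa))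

lemma2 : (n : ℕ) → 4 < n → (f : PColoring) → ColorsAllBut23 n f → PartialStar n f →
    (∃ (λ g → StarColoring n g × Extends n f g))
      ⇔ (n ≤ 5 ⊎ (f 4 ≡ f 0 ⊎ f 4 ≡ f 1) ⊎ f 5 ≢ f 0)
lemma2 n 4<n f CA PS = mk⇔ (necessity CA) (sufficiency 4<n CA PS)
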